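{- Let $G$ be a connected graph. The following statements are equivalent: (i) $\mu_t(G)=|\mathcal{C}(G)|$; (ii) $\mu_t(G)= {\rm n}(G)-|\mathcal{F}(G)|$; (iii) $|\mathcal{C}(G)|+|\mathcal{F}(G)|={\rm n}(G)$.
   Context: All graphs are finite, simple and undirected; ${\rm n}(G)$ is the order of $G$. For $X\subseteq V(G)$, two vertices $x,y\in V(G)$ are $X$-visible if there is a shortest $x,y$-path in $G$ none of whose internal vertices lies in $X$. $X$ is a total mutual-visibility set of $G$ if every two vertices of $G$ are $X$-visible; $\mu_t(G)$ is the maximum cardinality of such a set, and a $\mu_t(G)$-set is a total mutual-visibility set of cardinality $\mu_t(G)$. $\mathcal{C}(G)$ is the set of vertices belonging to every $\mu_t(G)$-set, and $\mathcal{F}(G)$ is the set of vertices belonging to no $\mu_t(G)$-set. -}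

module Defs where

open import Data.Nat using (ℕ; zero; suc; _+_; _∸_; _≤_)
open import Data.Bool using (Bool; true; false; T)
open import Data.Fin using (Fin)
open import Data.Fin.Subset using (Subset; _∈_; _∉_; ∣_∣)
open import Data.List using (List; []; _∷_)
open import Data.List.Relation.Unary.All using (All)
open import Data.Product using (Σ; ∃; _×_; _,_)
open import Relation.Binary.PropositionalEquality using (_≡_)
open import Function.Bundles using (_⇔_)

record Graph : Set where
  field
    n     : ℕ
    adj   : Fin n → Fin n → Bool
    sym   : ∀ x y → adj x y ≡ adj y x
    irref : ∀ x → adj x x ≡ false

open Graph public

module _ (G : Graph) where
  V : Set
  V = Fin (n G)

  Adj : V → V → Set
  Adj x y = T (adj G x y)

  data Walk : V → V → Set where
    [_]    : (x : V) → Walk x x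
    _∷⟨_⟩_ : ∀ {y z} (x : V) → Adj x y → Walk y z → Walk x z

  len : ∀ {x z} → Walk x z → ℕ
  len [ x ] = zero
  len (x ∷⟨ _ ⟩ w) = suc (len w)

  allButLast : ∀ {x z} → Walk x z → List V
  allButLast [ x ] = []
  allButLast (x ∷⟨ _ ⟩ w) = x ∷ allButLast w

  internal : ∀ {x z} → Walk x z → List V
  internal [ x ] = []
  internal (x ∷⟨ _ ⟩ w) = allButLast w

  IsShortest : ∀ {x z} → Walk x z → Set
  IsShortest {x} {z} w = ∀ (w' : Walk x z) → len w ≤ len w'

  Connected : Set
  Connected = ∀ (x y : V) → Walk x y

  Visible : Subset (n G) → V → V → Set
  Visible X x y = Σ (Walk x y) λ w → IsShortest w × All (λ v → v ∉ X) (internal w)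

  IsTMV : Subset (n G) → Set
  IsTMV X = ∀ (x y : V) → Visible X x y

  IsMuTSet : Subset (n G) → Set
  IsMuTSet X = IsTMV X × (∀ Y → IsTMV Y → ∣ Y ∣ ≤ ∣ X ∣)

  IsMuT : ℕ → Set
  IsMuT k = Σ (Subset (n G)) λ X → IsMuTSet X × ∣ X ∣ ≡ k

  IsCore : Subset (n G) → Set
  IsCore S = ∀ (v : V) → (v ∈ S) ⇔ (∀ X → IsMuTSet X → v ∈ X)

  IsFree : Subset (n G) → Set
  IsFree S = ∀ (v : V) → (v ∈ S) ⇔ (∀ X → IsMuTSet X → v ∉ X)

{-# OPTIONS --safe #-}
module Submission where

open import Defs using (Graph; n; Connected; IsMuT; IsMuTSet; IsCore; IsFree)
open import Data.Nat using (ℕ; _+_; _∸_; _≤_)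
open import Data.Nat.Properties using (≤-antisym; <⇒≢; m+n∸n≡m; m∸n+n≡m)
open import Data.Fin.Subset using (Subset; ∣_∣; _⊆_; _∈_; _∉_; ∁)
open import Data.Fin.Subset.Properties
  using (p⊆q⇒∣p∣≤∣q∣; p⊂q⇒∣p∣<∣q∣; _∈?_; x∉p⇒x∈∁p; x∈∁p⇒x∉p; ∣∁p∣≡n∸∣p∣; ∣p∣≤n)
open import Data.Product using (_×_; _,_)
open import Data.Empty using (⊥-elim)
open import Relation.Nullary using (yes; no)
open import Relation.Binary.PropositionalEquality using (_≡_; sym; trans; cong)
open import Function.Base using (_∘_)
open import Function.Bundles using (_⇔_; mk⇔; Equivalence)
open import Function.Construct.Composition using (_⇔-∘_)
open import Function.Construct.Symmetry using (⇔-sym)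

-- Each of the three conditions says that C = ∁ F: every μ_t-set X satisfies C ⊆ X ⊆ ∁ F,
-- and all these sets have cardinality μ_t, so an equality of cardinalities between any
-- two of C, X, ∁ F collapses the chain.

p⊆q∧∣p∣≡∣q∣⇒q⊆p : ∀ {m} {p q : Subset m} → p ⊆ q → ∣ p ∣ ≡ ∣ q ∣ → q ⊆ p
p⊆q∧∣p∣≡∣q∣⇒q⊆p {p = p} p⊆q ∣p∣≡∣q∣ {x} x∈q with x ∈? p
... | yes x∈p = x∈p
... | no  x∉p = ⊥-elim (<⇒≢ (p⊂q⇒∣p∣<∣q∣ (p⊆q , x , x∈q , x∉p)) ∣p∣≡∣q∣)

m+n≡o⇔m≡o∸n : ∀ {m n o} → n ≤ o → (m + n ≡ o) ⇔ (m ≡ o ∸ n)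
m+n≡o⇔m≡o∸n {m} {n} n≤o = mk⇔
  (λ m+n≡o → trans (sym (m+n∸n≡m m n)) (cong (_∸ n) m+n≡o))
  (λ m≡o∸n → trans (cong (_+ n) m≡o∸n) (m∸n+n≡m n≤o))

module CoreAndFree
  {m : ℕ} (Max : Subset m → Set) {k : ℕ} (∣Max∣≡k : ∀ {Y} → Max Y → ∣ Y ∣ ≡ k)
  {X : Subset m} (Max-X : Max X) {C F : Subset m}
  (core : ∀ v → (v ∈ C) ⇔ (∀ Y → Max Y → v ∈ Y))
  (free : ∀ v → (v ∈ F) ⇔ (∀ Y → Max Y → v ∉ Y))
  where

  core⊆max : ∀ {Y} → Max Y → C ⊆ Y
  core⊆max {Y} Max-Y v∈C = Equivalence.to (core _) v∈C Y Max-Y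

  max⊆∁free : ∀ {Y} → Max Y → Y ⊆ ∁ F
  max⊆∁free {Y} Max-Y v∈Y = x∉p⇒x∈∁p λ v∈F → Equivalence.to (free _) v∈F Y Max-Y v∈Y

  core⊆∁free : C ⊆ ∁ F
  core⊆∁free v∈C = max⊆∁free Max-X (core⊆max Max-X v∈C)

  ∣∁free∣≡m∸∣free∣ : ∣ ∁ F ∣ ≡ m ∸ ∣ F ∣
  ∣∁free∣≡m∸∣free∣ = ∣∁p∣≡n∸∣p∣ F

  k≡∣core∣⇒∁free⊆core : k ≡ ∣ C ∣ → ∁ F ⊆ C
  k≡∣core∣⇒∁free⊆core k≡∣C∣ {v} v∈∁F with v ∈? C
  ... | yes v∈C = v∈C
  ... | no  v∉C = ⊥-elim (x∈∁p⇒x∉p v∈∁F (Equivalence.from (free v) v∉max))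
    where
    v∉max : ∀ Y → Max Y → v ∉ Y
    v∉max Y Max-Y = v∉C ∘ p⊆q∧∣p∣≡∣q∣⇒q⊆p (core⊆max Max-Y)
      (trans (sym k≡∣C∣) (sym (∣Max∣≡k Max-Y)))

  k≡m∸∣free∣⇒∁free⊆core : k ≡ m ∸ ∣ F ∣ → ∁ F ⊆ C
  k≡m∸∣free∣⇒∁free⊆core k≡m∸∣F∣ v∈∁F = Equivalence.from (core _) λ Y Max-Y →
    p⊆q∧∣p∣≡∣q∣⇒q⊆p (max⊆∁free Max-Y)
      (trans (∣Max∣≡k Max-Y) (trans k≡m∸∣F∣ (sym ∣∁free∣≡m∸∣free∣))) v∈∁F

  ∣core∣≡m∸∣free∣⇒∁free⊆core : ∣ C ∣ ≡ m ∸ ∣ F ∣ → ∁ F ⊆ C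
  ∣core∣≡m∸∣free∣⇒∁free⊆core ∣C∣≡m∸∣F∣ =
    p⊆q∧∣p∣≡∣q∣⇒q⊆p core⊆∁free (trans ∣C∣≡m∸∣F∣ (sym ∣∁free∣≡m∸∣free∣))

  module _ (∁F⊆C : ∁ F ⊆ C) where

    k≡∣core∣ : k ≡ ∣ C ∣
    k≡∣core∣ = trans (sym (∣Max∣≡k Max-X)) (≤-antisym
      (p⊆q⇒∣p∣≤∣q∣ (λ v∈X → ∁F⊆C (max⊆∁free Max-X v∈X))) (p⊆q⇒∣p∣≤∣q∣ (core⊆max Max-X)))

    ∣core∣≡∣∁free∣ : ∣ C ∣ ≡ ∣ ∁ F ∣
    ∣core∣≡∣∁free∣ = ≤-antisym (p⊆q⇒∣p∣≤∣q∣ core⊆∁free) (p⊆q⇒∣p∣≤∣q∣ ∁F⊆C)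

    ∣core∣≡m∸∣free∣ : ∣ C ∣ ≡ m ∸ ∣ F ∣
    ∣core∣≡m∸∣free∣ = trans ∣core∣≡∣∁free∣ ∣∁free∣≡m∸∣free∣

    k≡m∸∣free∣ : k ≡ m ∸ ∣ F ∣
    k≡m∸∣free∣ = trans k≡∣core∣ ∣core∣≡m∸∣free∣

  k≡∣core∣⇔∁free⊆core : (k ≡ ∣ C ∣) ⇔ (∁ F ⊆ C)
  k≡∣core∣⇔∁free⊆core = mk⇔ k≡∣core∣⇒∁free⊆core k≡∣core∣

  k≡m∸∣free∣⇔∁free⊆core : (k ≡ m ∸ ∣ F ∣) ⇔ (∁ F ⊆ C)
  k≡m∸∣free∣⇔∁free⊆core = mk⇔ k≡m∸∣free∣⇒∁free⊆core k≡m∸∣free∣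

  ∣core∣+∣free∣≡m⇔∁free⊆core : (∣ C ∣ + ∣ F ∣ ≡ m) ⇔ (∁ F ⊆ C)
  ∣core∣+∣free∣≡m⇔∁free⊆core =
    mk⇔ ∣core∣≡m∸∣free∣⇒∁free⊆core ∣core∣≡m∸∣free∣ ⇔-∘ m+n≡o⇔m≡o∸n (∣p∣≤n F)

proposition3p2 : (G : Graph) → Connected G →
    (k : ℕ) (C F : Subset (n G)) →
    IsMuT G k → IsCore G C → IsFree G F →
    ((k ≡ ∣ C ∣) ⇔ (k ≡ n G ∸ ∣ F ∣)) × ((k ≡ n G ∸ ∣ F ∣) ⇔ (∣ C ∣ + ∣ F ∣ ≡ n G))
proposition3p2 G _ k C F (X , Max-X@(tmv-X , max-X) , ∣X∣≡k) core free =
  ⇔-sym ii⇔∁F⊆C ⇔-∘ i⇔∁F⊆C , ⇔-sym iii⇔∁F⊆C ⇔-∘ ii⇔∁F⊆C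
  where
  ∣μ-set∣≡k : ∀ {Y} → IsMuTSet G Y → ∣ Y ∣ ≡ k
  ∣μ-set∣≡k {Y} (tmv-Y , max-Y) = trans (≤-antisym (max-X Y tmv-Y) (max-Y X tmv-X)) ∣X∣≡k

  open CoreAndFree (IsMuTSet G) ∣μ-set∣≡k Max-X core free
    renaming ( k≡∣core∣⇔∁free⊆core to i⇔∁F⊆C
             ; k≡m∸∣free∣⇔∁free⊆core to ii⇔∁F⊆C
             ; ∣core∣+∣free∣≡m⇔∁free⊆core to iii⇔∁F⊆C )
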